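{- Fix an integer $n\ge 0$ and start the chip-firing game on the quadrant lattice graph with $2^n$ chips at $(0,0)$. Let $i$ be the largest index of a row on which the intermediate firing configuration $F$ has a nonzero entry. Then row $i$ is the last row containing chips in the stable configuration, and for every vertex $(x,y)$ in row $i$ the number of chips at $(x,y)$ in the stable configuration equals $F(x,y)$.
   Context: The quadrant lattice graph is the directed graph with vertex set $\{(x,y): x,y\in\mathbb{Z}_{\ge 0}\}$ and edges $(x,y)\to(x+1,y)$ and $(x,y)\to(x,y+1)$. In the chip-firing game, a vertex holding at least $2$ chips may fire, sending one chip to each of its two out-neighbours. Starting from $2^n$ chips at $(0,0)$ the process terminates at a stable configuration (no vertex can fire) independent of the order of firings. Row $i$ consists of the vertices with $x+y=i$. The intermediate firing configuration $F(x,y)$ is the number of chips at $(x,y)$ after all rows with index less than $x+y$ have been fired until none of their vertices can fire, and before row $x+y$ fires. Equivalently, $F(0,0)=2^n$, $F(x,y)=\lfloor F(x-1,y)/2\rfloor+\lfloor F(x,y-1)/2\rfloor$ for every other $(x,y)\in\mathbb{Z}_{\ge0}^2$, and $F(x,y)=0$ outside the first quadrant. Only finitely many rows of $F$ are nonzero. -}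

module Defs where

open import Data.Nat using (ℕ; zero; suc; _+_; _*_; _∸_; _^_; _≤_; _<_; _/_)
open import Data.Nat.Properties using (_≟_)
open import Data.Product using (Σ; _×_)
open import Data.Bool using (Bool; true; false; _∧_)
open import Relation.Nullary.Decidable using (⌊_⌋)
open import Relation.Binary.PropositionalEquality using (_≡_)
open import Relation.Binary.Construct.Closure.ReflexiveTransitive using (Star)

Config : Set
Config = ℕ → ℕ → ℕ

initial : ℕ → Config
initial n zero zero = 2 ^ n
initial n _    _    = 0

δ : ℕ → ℕ → ℕ → ℕ → ℕ
δ x y a b with ⌊ a ≟ x ⌋ ∧ ⌊ b ≟ y ⌋
... | true  = 1
... | false = 0

fire : ℕ → ℕ → Config → Config
fire x y C a b = (C a b ∸ 2 * δ x y a b) + δ (suc x) y a b + δ x (suc y) a b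

Step : Config → Config → Set
Step C D = Σ ℕ λ x → Σ ℕ λ y → (2 ≤ C x y) × (∀ a b → D a b ≡ fire x y C a b)

Reachable : Config → Config → Set
Reachable = Star Step

Stable : Config → Set
Stable C = ∀ x y → C x y < 2

F : ℕ → ℕ → ℕ → ℕ
F n zero    zero    = 2 ^ n
F n (suc x) zero    = F n x zero / 2
F n zero    (suc y) = F n zero y / 2
F n (suc x) (suc y) = F n x (suc y) / 2 + F n (suc x) y / 2

{-# OPTIONS --safe #-}
-- Let u count how often each vertex has fired. Conservation of chips along any firing
-- sequence gives C + 2u = 2ⁿ·[(a,b) = (0,0)] + u(a-1,b) + u(a,b-1). If C is stable then
-- C < 2 forces u = ⌊received/2⌋, which is the recursion defining F; so each vertex has
-- received exactly F chips and C = F mod 2. Beyond row i F vanishes, and on row i F < 2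
-- because F(x+1,y) ≥ ⌊F(x,y)/2⌋, so there C = F.
module Submission where

open import Defs
open import Data.Nat using (ℕ; _+_; _<_)
open import Data.Product using (Σ; _×_)
open import Relation.Nullary using (¬_)
open import Relation.Binary.PropositionalEquality using (_≡_)

open import Data.Nat using (zero; suc; _*_; _∸_; _≤_; _/_; _%_; z≤n; NonZero)
open import Data.Nat.Properties
  using (_≟_; suc-injective; +-identityʳ; +-assoc; m∸n+n≡m; m≤m+n; ≤-refl; ≤-trans; ≤-reflexive; n≤0⇒n≡0; n<1+n)
open import Data.Nat.DivMod
  using (+-distrib-/-∣ʳ; m<n⇒m/n≡0; m*n/n≡m; [m+kn]%n≡m%n; m<n⇒m%n≡m; m/n≡0⇒m<n; /-congˡ)
open import Data.Nat.Divisibility using (divides-refl)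
open import Data.Nat.Solver using (module +-*-Solver)
open import Data.Product using (∃; _,_; proj₁; proj₂)
open import Function using (_∘_)
open import Relation.Nullary using (yes; no; contradiction; _×-dec_)
open import Relation.Binary.PropositionalEquality using (refl; sym; trans; cong; cong₂; module ≡-Reasoning)
open import Relation.Binary.Construct.Closure.ReflexiveTransitive using (ε; _◅_)

δ-hit : ∀ x y → δ x y x y ≡ 1
δ-hit x y with x ≟ x | y ≟ y
... | yes _ | yes _ = refl
... | yes _ | no y≢y = contradiction refl y≢y
... | no x≢x | _ = contradiction refl x≢x

δ-miss : ∀ {x y a b} → ¬ (a ≡ x × b ≡ y) → δ x y a b ≡ 0
δ-miss {x} {y} {a} {b} miss with a ≟ x | b ≟ y
... | yes a≡x | yes b≡y = contradiction (a≡x , b≡y) miss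
... | yes _ | no _ = refl
... | no _ | _ = refl

δ-sucˣ : ∀ x y a b → δ (suc x) y (suc a) b ≡ δ x y a b
δ-sucˣ x y a b with a ≟ x ×-dec b ≟ y
... | yes (refl , refl) = trans (δ-hit (suc x) y) (sym (δ-hit x y))
... | no miss = trans (δ-miss (λ (sa≡sx , b≡y) → miss (suc-injective sa≡sx , b≡y)))
                      (sym (δ-miss miss))

δ-sucʸ : ∀ x y a b → δ x (suc y) a (suc b) ≡ δ x y a b
δ-sucʸ x y a b with a ≟ x ×-dec b ≟ y
... | yes (refl , refl) = trans (δ-hit x (suc y)) (sym (δ-hit x y))
... | no miss = trans (δ-miss (λ (a≡x , sb≡sy) → miss (a≡x , suc-injective sb≡sy)))
                      (sym (δ-miss miss))

2*δ≤ : ∀ {C : Config} x y a b → 2 ≤ C x y → 2 * δ x y a b ≤ C a b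
2*δ≤ x y a b 2≤Cxy with a ≟ x | b ≟ y
... | yes refl | yes refl = 2≤Cxy
... | yes _ | no _ = z≤n
... | no _ | _ = z≤n

inflow : (ℕ → ℕ → ℕ) → Config
inflow u zero    zero    = 0
inflow u (suc a) zero    = u a zero
inflow u zero    (suc b) = u zero b
inflow u (suc a) (suc b) = u a (suc b) + u (suc a) b

inflow-+ : ∀ u v a b → inflow (λ x y → u x y + v x y) a b ≡ inflow u a b + inflow v a b
inflow-+ u v zero    zero    = refl
inflow-+ u v (suc a) zero    = refl
inflow-+ u v zero    (suc b) = refl
inflow-+ u v (suc a) (suc b) = solve 4 (λ p q r s → (p :+ q) :+ (r :+ s) := (p :+ r) :+ (q :+ s)) refl
  (u a (suc b)) (v a (suc b)) (u (suc a) b) (v (suc a) b)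
  where open +-*-Solver

inflow-δ : ∀ x y a b → inflow (δ x y) a b ≡ δ (suc x) y a b + δ x (suc y) a b
inflow-δ x y zero    zero    = sym (δ-miss {x} {suc y} {zero} {zero} (λ { (_ , ()) }))
inflow-δ x y (suc a) zero    = sym (trans (cong₂ _+_ (δ-sucˣ x y a zero)
                                                     (δ-miss {x} {suc y} {suc a} {zero} (λ { (_ , ()) })))
                                          (+-identityʳ _))
inflow-δ x y zero    (suc b) = sym (δ-sucʸ x y zero b)
inflow-δ x y (suc a) (suc b) = sym (cong₂ _+_ (δ-sucˣ x y a (suc b)) (δ-sucʸ x y (suc a) b))

-- Chip balance of C against C₀ after each vertex has fired u times; legality of the
-- firings is not recorded.
Odometer : Config → Config → (ℕ → ℕ → ℕ) → Set
Odometer C₀ C u = ∀ a b → C a b + u a b * 2 ≡ C₀ a b + inflow u a b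

odometer-refl : ∀ C₀ → Odometer C₀ C₀ (λ _ _ → 0)
odometer-refl C₀ zero    zero    = refl
odometer-refl C₀ (suc a) zero    = refl
odometer-refl C₀ zero    (suc b) = refl
odometer-refl C₀ (suc a) (suc b) = refl

odometer-step : ∀ {C₀ C D u} → Odometer C₀ C u → Step C D → ∃ (Odometer C₀ D)
odometer-step {C₀} {C} {D} {u} odo (x , y , 2≤Cxy , D≡fire) = (λ a b → u a b + δ x y a b) , balance
  where
  balance : Odometer C₀ D (λ a b → u a b + δ x y a b)
  balance a b = begin
      D a b + (u a b + d) * 2
    ≡⟨ cong (_+ (u a b + d) * 2) (D≡fire a b) ⟩
      (C a b ∸ 2 * d) + e + e′ + (u a b + d) * 2
    ≡⟨ regroup (C a b ∸ 2 * d) d (u a b) e e′ ⟩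
      (C a b ∸ 2 * d + 2 * d) + u a b * 2 + (e + e′)
    ≡⟨ cong (λ c → c + u a b * 2 + (e + e′)) (m∸n+n≡m (2*δ≤ x y a b 2≤Cxy)) ⟩
      C a b + u a b * 2 + (e + e′)
    ≡⟨ cong (_+ (e + e′)) (odo a b) ⟩
      C₀ a b + inflow u a b + (e + e′)
    ≡⟨ +-assoc (C₀ a b) _ _ ⟩
      C₀ a b + (inflow u a b + (e + e′))
    ≡⟨ cong (λ z → C₀ a b + (inflow u a b + z)) (inflow-δ x y a b) ⟨
      C₀ a b + (inflow u a b + inflow (δ x y) a b)
    ≡⟨ cong (C₀ a b +_) (inflow-+ u (δ x y) a b) ⟨
      C₀ a b + inflow (λ a b → u a b + δ x y a b) a b
    ∎
    where
    open ≡-Reasoning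
    open +-*-Solver
    d = δ x y a b
    e = δ (suc x) y a b
    e′ = δ x (suc y) a b
    regroup : ∀ c d u e e′ → c + e + e′ + (u + d) * 2 ≡ (c + 2 * d) + u * 2 + (e + e′)
    regroup = solve 5 (λ c d u e e′ → c :+ e :+ e′ :+ (u :+ d) :* con 2
                       := (c :+ con 2 :* d) :+ u :* con 2 :+ (e :+ e′)) refl

odometer-reachable : ∀ {C₀ C D u} → Odometer C₀ C u → Reachable C D → ∃ (Odometer C₀ D)
odometer-reachable odo ε        = _ , odo
odometer-reachable odo (s ◅ ss) = odometer-reachable (proj₂ (odometer-step odo s)) ss

m<n⇒[m+kn]/n≡k : ∀ m k n .{{_ : NonZero n}} → m < n → (m + k * n) / n ≡ k
m<n⇒[m+kn]/n≡k m k n m<n = begin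
  (m + k * n) / n     ≡⟨ +-distrib-/-∣ʳ m (divides-refl k) ⟩
  m / n + k * n / n   ≡⟨ cong₂ _+_ (m<n⇒m/n≡0 m<n) (m*n/n≡m k n) ⟩
  k                   ∎
  where open ≡-Reasoning

m<n⇒[m+kn]%n≡m : ∀ m k n .{{_ : NonZero n}} → m < n → (m + k * n) % n ≡ m
m<n⇒[m+kn]%n≡m m k n m<n = trans ([m+kn]%n≡m%n m k n) (m<n⇒m%n≡m m<n)

module StableOdometer {n} {C u} (stable : Stable C) (odo : Odometer (initial n) C u) where

  mutual
    received≡F : ∀ a b → initial n a b + inflow u a b ≡ F n a b
    received≡F zero    zero    = +-identityʳ _
    received≡F (suc a) zero    = odometer≡F/2 a zero
    received≡F zero    (suc b) = odometer≡F/2 zero b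
    received≡F (suc a) (suc b) = cong₂ _+_ (odometer≡F/2 a (suc b)) (odometer≡F/2 (suc a) b)

    odometer≡F/2 : ∀ a b → u a b ≡ F n a b / 2
    odometer≡F/2 a b = trans (sym (m<n⇒[m+kn]/n≡k (C a b) (u a b) 2 (stable a b)))
                             (/-congˡ (balance a b))

    balance : ∀ a b → C a b + u a b * 2 ≡ F n a b
    balance a b = trans (odo a b) (received≡F a b)

stable-reachable⇒≡F%2 : ∀ {n C} → Reachable (initial n) C → Stable C → ∀ a b → C a b ≡ F n a b % 2
stable-reachable⇒≡F%2 {n} {C} reach stable a b = begin
    C a b                      ≡⟨ sym (m<n⇒[m+kn]%n≡m (C a b) (u a b) 2 (stable a b)) ⟩
    (C a b + u a b * 2) % 2    ≡⟨ cong (_% 2) (balance a b) ⟩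
    F n a b % 2                ∎
  where
  open ≡-Reasoning
  odometer : ∃ (Odometer (initial n) C)
  odometer = odometer-reachable (odometer-refl (initial n)) reach
  u : ℕ → ℕ → ℕ
  u = proj₁ odometer
  open StableOdometer stable (proj₂ odometer)

F/2≤F-sucˣ : ∀ n x y → F n x y / 2 ≤ F n (suc x) y
F/2≤F-sucˣ n x zero    = ≤-refl
F/2≤F-sucˣ n x (suc y) = m≤m+n _ _

F-sucˣ≡0⇒F<2 : ∀ n x y → F n (suc x) y ≡ 0 → F n x y < 2
F-sucˣ≡0⇒F<2 n x y F≡0 = m/n≡0⇒m<n (n≤0⇒n≡0 (≤-trans (F/2≤F-sucˣ n x y) (≤-reflexive F≡0)))

proposition4p3 : (n i : ℕ)
    → (Σ ℕ λ x → Σ ℕ λ y → (x + y ≡ i) × ¬ (F n x y ≡ 0))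
    → (∀ x y → i < x + y → F n x y ≡ 0)
    → (C : Config) → Reachable (initial n) C → Stable C
    → (∀ x y → i < x + y → C x y ≡ 0)
    × (Σ ℕ λ x → Σ ℕ λ y → (x + y ≡ i) × ¬ (C x y ≡ 0))
    × (∀ x y → x + y ≡ i → C x y ≡ F n x y)
proposition4p3 n i (x₀ , y₀ , x₀+y₀≡i , F≢0) F≡0 C reach stable =
  C≡0 , (x₀ , y₀ , x₀+y₀≡i , F≢0 ∘ trans (sym (C≡F x₀ y₀ x₀+y₀≡i))) , C≡F
  where
  C≡F%2 : ∀ x y → C x y ≡ F n x y % 2
  C≡F%2 = stable-reachable⇒≡F%2 reach stable

  C≡0 : ∀ x y → i < x + y → C x y ≡ 0
  C≡0 x y i<x+y = trans (C≡F%2 x y) (cong (_% 2) (F≡0 x y i<x+y))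

  C≡F : ∀ x y → x + y ≡ i → C x y ≡ F n x y
  C≡F x y refl = trans (C≡F%2 x y) (m<n⇒m%n≡m (F-sucˣ≡0⇒F<2 n x y (F≡0 (suc x) y (n<1+n (x + y)))))
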